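{- Let $H$ be a reflective connected bipartite graph, let $X$ be one of the parts of its bipartition and let $R\subset X$ with $|R|=2$. Then there is a positive integer $s$ such that for every graph $G$, $$\hom(H,G;X)\geq \frac{\hom(H,G;R)^s}{\hom(H,G)^{s-1}}.$$
   Context: A homomorphism $H\to G$ is a map $V(H)\to V(G)$ sending edges to edges; $\hom(H,G)$ is their number and, for $R\subset V(H)$, $\hom(H,G;R)$ is the number of homomorphisms mapping all vertices of $R$ to the same vertex of $G$. For an automorphism $\phi$ of $H$ let $F_\phi=\{v\in V(H):\phi(v)=v\}$. For a connected bipartite graph $H$, a triple $(A,B,\phi)$ with $A,B\subset V(H)$ and $\phi$ an automorphism of $H$ is nice if $\phi=\phi^{ -1}$; $A$, $B$, $F_\phi$ partition $V(H)$; $F_\phi$ separates $A$ from $B$ (no edge of $H$ joins $A$ and $B$); and $\phi(A)=B$. A set $R\subset V(H)$ is admissible for $(A,B,\phi)$ if all vertices of $R$ lie in the same part of the bipartition of $H$ and $R$ intersects both $A\cup F_\phi$ and $B\cup F_\phi$. Define $\psi_{A,B,\phi}(R)=(R\cap(A\cup F_\phi))\cup\phi(R\cap A)$. A connected bipartite graph $H$ with parts $X_1,X_2$ is reflective if for every $i\in\{1,2\}$ and every $R\subset X_i$ with $|R|=2$ there exist nice triples $(A_j,B_j,\phi_j)$, $j=0,\dots,m-1$, and sets $R_0,\dots,R_m$ with $R_j$ admissible for $(A_j,B_j,\phi_j)$, $R_0=R$, $R_m=X_i$ and $R_{j+1}=\psi_{A_j,B_j,\phi_j}(R_j)$ for all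 $0\leq j\leq m-1$. -}

module Defs where

open import Data.Nat using (ℕ; zero; suc)
open import Data.Bool using (Bool; true; false; T?)
import Data.Bool as Bool
open import Data.Fin using (Fin; zero; suc)
open import Data.Fin.Properties using (all?; _≟_)
open import Data.Fin.Subset using (Subset; _∈_; _∉_)
open import Data.Fin.Subset.Properties using (_∈?_)
open import Data.List using (List; []; _∷_; map; concatMap; filter; length)
open import Data.List.Base using ([_]; allFin)
import Data.Vec.Functional as VF
open import Data.Vec using (tabulate)
open import Data.Product using (Σ; ∃; ∃-syntax; _×_; _,_)
open import Data.Sum using (_⊎_)
open import Relation.Nullary using (Dec; ¬_; does)
open import Relation.Nullary.Decidable using (_→-dec_)
open import Relation.Binary.PropositionalEquality using (_≡_; _≢_)
open import Function.Bundles using (_⇔_)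

record Graph : Set where
  field
    n      : ℕ
    adj    : Fin n → Fin n → Bool
    sym    : ∀ i j → adj i j ≡ adj j i
    irrefl : ∀ i → adj i i ≡ false

open Graph public

V : Graph → Set
V H = Fin (n H)

Edge : (H : Graph) → V H → V H → Set
Edge H i j = adj H i j ≡ true

IsHom : (H G : Graph) → (V H → V G) → Set
IsHom H G f = ∀ i j → Edge H i j → Edge G (f i) (f j)

isHom? : (H G : Graph) → (f : V H → V G) → Dec (IsHom H G f)
isHom? H G f =
  all? (λ i → all? (λ j → (adj H i j Bool.≟ true) →-dec (adj G (f i) (f j) Bool.≟ true)))

-- the list of all functions Fin k → Fin m (each exactly once)
allFuns : (k m : ℕ) → List (Fin k → Fin m)
allFuns zero    m = [ (λ ()) ]
allFuns (suc k) m =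
  concatMap (λ a → map (λ f → a VF.∷ f) (allFuns k m)) (allFin m)

Collapses : (H G : Graph) → Subset (n H) → (V H → V G) → Set
Collapses H G R f = ∀ i j → i ∈ R → j ∈ R → f i ≡ f j

collapses? : (H G : Graph) (R : Subset (n H)) (f : V H → V G) → Dec (Collapses H G R f)
collapses? H G R f =
  all? (λ i → all? (λ j → (i ∈? R) →-dec ((j ∈? R) →-dec (f i ≟ f j))))

hom : Graph → Graph → ℕ
hom H G = length (filter (isHom? H G) (allFuns (n H) (n G)))

homR : (H G : Graph) → Subset (n H) → ℕ
homR H G R =
  length (filter (λ f → collapses? H G R f) (filter (isHom? H G) (allFuns (n H) (n G))))

data Reach (H : Graph) : V H → V H → Set where
  here : ∀ {i} → Reach H i i
  step : ∀ {i j k} → Edge H i j → Reach H j k → Reach H i k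

Connected : Graph → Set
Connected H = ∀ i j → Reach H i j

-- a proper 2-colouring; its colour classes are the parts X₁, X₂
ProperColouring : (H : Graph) → (V H → Bool) → Set
ProperColouring H col = ∀ i j → Edge H i j → col i ≢ col j

part : (H : Graph) → (V H → Bool) → Bool → Subset (n H)
part H col b = tabulate (λ v → does (col v Bool.≟ b))

record Automorphism (H : Graph) : Set where
  field
    to      : V H → V H
    from    : V H → V H
    to-from : ∀ v → to (from v) ≡ v
    from-to : ∀ v → from (to v) ≡ v
    pres    : ∀ i j → adj H (to i) (to j) ≡ adj H i j

open Automorphism public

Fixed : {H : Graph} → Automorphism H → V H → Set
Fixed φ v = to φ v ≡ v

record Nice (H : Graph) (A B : Subset (n H)) (φ : Automorphism H) : Set where
  field
    self-inverse : ∀ v → to φ v ≡ from φ v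
    covers       : ∀ v → v ∈ A ⊎ v ∈ B ⊎ Fixed φ v
    disjAB       : ∀ v → v ∈ A → v ∉ B
    disjAF       : ∀ v → v ∈ A → ¬ Fixed φ v
    disjBF       : ∀ v → v ∈ B → ¬ Fixed φ v
    separates    : ∀ a b → a ∈ A → b ∈ B → ¬ Edge H a b
    imageA⊆B     : ∀ v → v ∈ A → to φ v ∈ B
    B⊆imageA     : ∀ w → w ∈ B → ∃[ v ] (v ∈ A × to φ v ≡ w)

Admissible : (H : Graph) (col : V H → Bool) (A B : Subset (n H)) (φ : Automorphism H)
             → Subset (n H) → Set
Admissible H col A B φ R =
  (∃[ b ] (∀ v → v ∈ R → col v ≡ b)) ×
  (∃[ v ] (v ∈ R × (v ∈ A ⊎ Fixed φ v))) ×
  (∃[ v ] (v ∈ R × (v ∈ B ⊎ Fixed φ v)))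

IsPsi : (H : Graph) (A B : Subset (n H)) (φ : Automorphism H) → Subset (n H) → Subset (n H) → Set
IsPsi H A B φ R R' =
  ∀ v → v ∈ R' ⇔ ((v ∈ R × (v ∈ A ⊎ Fixed φ v)) ⊎ (∃[ u ] (u ∈ R × u ∈ A × to φ u ≡ v)))

data ReflChain (H : Graph) (col : V H → Bool) (b : Bool) : Subset (n H) → Set where
  end  : ∀ {R} → (∀ v → v ∈ R ⇔ v ∈ part H col b) → ReflChain H col b R
  step : ∀ {R R'} (A B : Subset (n H)) (φ : Automorphism H)
         → Nice H A B φ → Admissible H col A B φ R → IsPsi H A B φ R R'
         → ReflChain H col b R' → ReflChain H col b R

Reflective : (H : Graph) → (V H → Bool) → Set
Reflective H col =
  Connected H × ProperColouring H col ×
  (∀ b (R : Subset (n H)) → (∀ v → v ∈ R → v ∈ part H col b) → Data.Fin.Subset.∣ R ∣ ≡ 2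
     → ReflChain H col b R)

{-# OPTIONS --safe #-}
module Submission where

-- Fix a nice triple (A, B, φ), an admissible R and R' = ψ(R). Classify the homomorphisms
-- collapsing R by the common image w of R and by their restriction g to F_φ. Since F_φ
-- separates A from B, the extensions of g to A and to B can be chosen independently, so
-- hom(H,G;R) = Σ_{w,g} x·y with x, y the numbers of suitable extensions to the two sides.
-- Applying φ turns the B-side of R' into the A-side of R, hence hom(H,G;R') = Σ x², and as R
-- meets B ∪ F_φ, w is determined by the B-side, which gives Σ y² ≤ hom(H,G). Cauchy–Schwarz
-- yields hom(H,G;R)² ≤ hom(H,G;R')·hom(H,G), and along the chain R = R₀, …, R_m = X
-- every step doubles the exponent.

open import Defs hiding (sym)
open import Data.Nat hiding (_≟_)
open import Data.Nat.Properties hiding (_≟_; suc-injective)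
open import Data.Nat.Tactic.RingSolver using (solve-∀)
open import Data.Bool using (Bool; true; false)
import Data.Bool as Bool
open import Data.Fin using (Fin; zero; suc; punchIn; punchOut)
open import Data.Fin.Properties using (_≟_; suc-injective; all?; punchIn-punchOut)
open import Data.Fin.Permutation using (Permutation; _⟨$⟩ʳ_; _⟨$⟩ˡ_; remove; inverseʳ; inverseˡ; permutation; punchIn-permute)
open import Data.Fin.Subset using (Subset; _∈_; _∉_; _⊆_; _∪_; ⊤; ∁; ∣_∣)
open import Data.Fin.Subset.Properties using (_∈?_; p∪∁p≡⊤; ∪-comm; x∈∁p⇒x∉p; x∈p∪q⁺)
open import Data.Vec.Base using ([]; _∷_; here; there)
open import Data.Vec.Functional using (head; tail; insertAt) renaming (_∷_ to _◂_)
open import Data.Vec.Functional.Properties using (insertAt-lookup; insertAt-punchIn)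
open import Data.List using (List; []; _∷_; _++_; map; concatMap; filter; length; cartesianProduct; allFin)
open import Data.List.Properties using (map-tabulate)
open import Data.List.Relation.Unary.All as All using (All; []; _∷_)
open import Data.List.Relation.Unary.All.Properties using (++⁺; map⁺)
open import Data.Product using (_×_; _,_; ∃-syntax; uncurry)
open import Data.Sum using (_⊎_; inj₁; inj₂; [_,_])
open import Data.Empty using (⊥-elim)
open import Function using (id; _∘_)
open import Function.Bundles using (_⇔_; Equivalence; mk⇔)
open import Relation.Nullary using (Dec; yes; no)
open import Relation.Nullary.Decidable using (_×-dec_; _→-dec_; ¬?)
open import Relation.Binary.PropositionalEquality hiding ([_])

ind : {P : Set} → Dec P → ℕ
ind (yes _) = 1
ind (no _)  = 0

ind-yes : {P : Set} (p : Dec P) → P → ind p ≡ 1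
ind-yes (yes _) _ = refl
ind-yes (no ¬p) p = ⊥-elim (¬p p)

module _ {P Q : Set} where

  ind-cong : (p : Dec P) (q : Dec Q) → (P → Q) → (Q → P) → ind p ≡ ind q
  ind-cong (yes _) (yes _) _   _   = refl
  ind-cong (yes p) (no ¬q) p⇒q _   = ⊥-elim (¬q (p⇒q p))
  ind-cong (no ¬p) (yes q) _   q⇒p = ⊥-elim (¬p (q⇒p q))
  ind-cong (no _)  (no _)  _   _   = refl

  ind-mono : (p : Dec P) (q : Dec Q) → (P → Q) → ind p ≤ ind q
  ind-mono (yes _) (yes _) _   = ≤-refl
  ind-mono (yes p) (no ¬q) p⇒q = ⊥-elim (¬q (p⇒q p))
  ind-mono (no _)  _       _   = z≤n

  ind-× : (p : Dec P) (q : Dec Q) → ind (p ×-dec q) ≡ ind p * ind q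
  ind-× (yes _) (yes _) = refl
  ind-× (yes _) (no _)  = refl
  ind-× (no _)  _       = refl

∑ : {A : Set} → List A → (A → ℕ) → ℕ
∑ []      w = 0
∑ (x ∷ L) w = w x + ∑ L w

syntax ∑ L (λ x → e) = ∑[ x ∈ L ] e

module _ {A : Set} where

  ∑-cong : (L : List A) {u v : A → ℕ} → (∀ x → u x ≡ v x) → ∑ L u ≡ ∑ L v
  ∑-cong []      _   = refl
  ∑-cong (x ∷ L) u≗v = cong₂ _+_ (u≗v x) (∑-cong L u≗v)

  ∑-cong-All : {L : List A} {u v : A → ℕ} → All (λ x → u x ≡ v x) L → ∑ L u ≡ ∑ L v
  ∑-cong-All []         = refl
  ∑-cong-All (e ∷ u≗v) = cong₂ _+_ e (∑-cong-All u≗v)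

  ∑-mono : (L : List A) {u v : A → ℕ} → (∀ x → u x ≤ v x) → ∑ L u ≤ ∑ L v
  ∑-mono []      _   = z≤n
  ∑-mono (x ∷ L) u≤v = +-mono-≤ (u≤v x) (∑-mono L u≤v)

  ∑-zero : (L : List A) → ∑[ x ∈ L ] 0 ≡ 0
  ∑-zero []      = refl
  ∑-zero (_ ∷ L) = ∑-zero L

  ∑-distrib-+ : (L : List A) (u v : A → ℕ) → ∑[ x ∈ L ] (u x + v x) ≡ ∑ L u + ∑ L v
  ∑-distrib-+ []      u v = refl
  ∑-distrib-+ (x ∷ L) u v rewrite ∑-distrib-+ L u v = +-exchange (u x) (v x) (∑ L u) (∑ L v)
    where
    +-exchange : ∀ a b c d → a + b + (c + d) ≡ a + c + (b + d)
    +-exchange = solve-∀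

  *-distribˡ-∑ : (L : List A) (c : ℕ) (u : A → ℕ) → c * ∑ L u ≡ ∑[ x ∈ L ] (c * u x)
  *-distribˡ-∑ []      c u = *-zeroʳ c
  *-distribˡ-∑ (x ∷ L) c u = trans (*-distribˡ-+ c (u x) (∑ L u)) (cong (c * u x +_) (*-distribˡ-∑ L c u))

  *-distribʳ-∑ : (L : List A) (c : ℕ) (u : A → ℕ) → ∑ L u * c ≡ ∑[ x ∈ L ] (u x * c)
  *-distribʳ-∑ []      c u = refl
  *-distribʳ-∑ (x ∷ L) c u = trans (*-distribʳ-+ c (u x) (∑ L u)) (cong (u x * c +_) (*-distribʳ-∑ L c u))

  ∑-++ : (L K : List A) (w : A → ℕ) → ∑ (L ++ K) w ≡ ∑ L w + ∑ K w
  ∑-++ []      K w = refl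
  ∑-++ (x ∷ L) K w = trans (cong (w x +_) (∑-++ L K w)) (sym (+-assoc (w x) (∑ L w) (∑ K w)))

  ∑-filter : {P : A → Set} (P? : ∀ x → Dec (P x)) (L : List A) (w : A → ℕ)
           → ∑ (filter P? L) w ≡ ∑[ x ∈ L ] (ind (P? x) * w x)
  ∑-filter P? []      w = refl
  ∑-filter P? (x ∷ L) w with P? x
  ... | yes _ = cong₂ _+_ (sym (+-identityʳ (w x))) (∑-filter P? L w)
  ... | no  _ = ∑-filter P? L w

  length-filter : {P : A → Set} (P? : ∀ x → Dec (P x)) (L : List A)
                → length (filter P? L) ≡ ∑[ x ∈ L ] ind (P? x)
  length-filter P? []      = refl
  length-filter P? (x ∷ L) with P? x
  ... | yes _ = cong suc (length-filter P? L)
  ... | no  _ = length-filter P? L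

module _ {A B : Set} where

  ∑-map : (f : A → B) (L : List A) (w : B → ℕ) → ∑ (map f L) w ≡ ∑[ x ∈ L ] w (f x)
  ∑-map f []      w = refl
  ∑-map f (x ∷ L) w = cong (w (f x) +_) (∑-map f L w)

  ∑-concatMap : (g : A → List B) (L : List A) (w : B → ℕ)
              → ∑ (concatMap g L) w ≡ ∑[ x ∈ L ] ∑ (g x) w
  ∑-concatMap g []      w = refl
  ∑-concatMap g (x ∷ L) w = trans (∑-++ (g x) (concatMap g L) w) (cong (∑ (g x) w +_) (∑-concatMap g L w))

  ∑-comm : (L : List A) (K : List B) (h : A → B → ℕ)
         → ∑[ a ∈ L ] ∑[ b ∈ K ] h a b ≡ ∑[ b ∈ K ] ∑[ a ∈ L ] h a b
  ∑-comm []      K h = sym (∑-zero K)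
  ∑-comm (x ∷ L) K h =
    trans (cong (∑ K (h x) +_) (∑-comm L K h)) (sym (∑-distrib-+ K (h x) (λ b → ∑[ a ∈ L ] h a b)))

∑-cartesianProduct : {A B : Set} (L : List A) (K : List B) (h : A → B → ℕ)
                   → ∑ (cartesianProduct L K) (uncurry h) ≡ ∑[ a ∈ L ] ∑[ b ∈ K ] h a b
∑-cartesianProduct []      K h = refl
∑-cartesianProduct (x ∷ L) K h =
  trans (∑-++ (map (x ,_) K) (cartesianProduct L K) (uncurry h))
        (cong₂ _+_ (∑-map (x ,_) K (uncurry h)) (∑-cartesianProduct L K h))

∑-allFin-suc : {m : ℕ} (w : Fin (suc m) → ℕ) → ∑ (allFin (suc m)) w ≡ w zero + ∑[ i ∈ allFin m ] w (suc i)
∑-allFin-suc {m} w = cong (w zero +_) (trans (cong (λ L → ∑ L w) (sym (map-tabulate id suc))) (∑-map suc (allFin m) w))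

∑-point : {m : ℕ} (c : Fin m) (X : Fin m → ℕ) → ∑[ i ∈ allFin m ] (ind (i ≟ c) * X i) ≡ X c
∑-point {suc m} zero X = begin
  ∑[ i ∈ allFin (suc m) ] (ind (i ≟ zero) * X i)                    ≡⟨ ∑-allFin-suc (λ i → ind (i ≟ zero) * X i) ⟩
  X zero + 0 + ∑[ i ∈ allFin m ] (ind (suc i ≟ zero) * X (suc i))   ≡⟨ cong₂ _+_ (+-identityʳ (X zero)) (∑-zero (allFin m)) ⟩
  X zero + 0                                                         ≡⟨ +-identityʳ (X zero) ⟩
  X zero                                                             ∎
  where open ≡-Reasoning
∑-point {suc m} (suc c) X = trans (∑-allFin-suc (λ i → ind (i ≟ suc c) * X i))
  (trans (∑-cong (allFin m) λ i → cong (_* X (suc i)) (ind-cong (suc i ≟ suc c) (i ≟ c) suc-injective (cong suc)))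
         (∑-point c (X ∘ suc)))

m*m≤n*n⇒m≤n : ∀ {m n} → m * m ≤ n * n → m ≤ n
m*m≤n*n⇒m≤n {m} {n} m²≤n² with m ≤? n
... | yes m≤n = m≤n
... | no  m≰n = ⊥-elim (<⇒≱ (*-mono-< (≰⇒> m≰n) (≰⇒> m≰n)) m²≤n²)

m≤n⇒2*m*n≤m*m+n*n : ∀ {m n} → m ≤ n → 2 * (m * n) ≤ m * m + n * n
m≤n⇒2*m*n≤m*m+n*n {m} m≤n with m≤n⇒∃[o]m+o≡n m≤n
... | d , refl = subst (2 * (m * (m + d)) ≤_) (sym (gap m d)) (m≤m+n _ (d * d))
  where
  gap : ∀ m d → m * m + (m + d) * (m + d) ≡ 2 * (m * (m + d)) + d * d
  gap = solve-∀

2*m*n≤m*m+n*n : ∀ m n → 2 * (m * n) ≤ m * m + n * n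
2*m*n≤m*m+n*n m n with ≤-total m n
... | inj₁ m≤n = m≤n⇒2*m*n≤m*m+n*n m≤n
... | inj₂ n≤m = subst₂ _≤_ (cong (2 *_) (*-comm n m)) (+-comm (n * n) (m * m)) (m≤n⇒2*m*n≤m*m+n*n n≤m)

-- AM-GM applied to P = x²Y and Q = Xy², after squaring.
cross-term-≤ : ∀ x y a X Y → a * a ≤ X * Y → 2 * (x * y * a) ≤ x * x * Y + X * (y * y)
cross-term-≤ x y a X Y a²≤XY = m*m≤n*n⇒m≤n (begin
  2 * (x * y * a) * (2 * (x * y * a))      ≡⟨ e₁ x y a ⟩
  4 * (x * x * (y * y)) * (a * a)          ≤⟨ *-monoʳ-≤ (4 * (x * x * (y * y))) a²≤XY ⟩
  4 * (x * x * (y * y)) * (X * Y)          ≡⟨ e₂ x y X Y ⟩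
  2 * (P * Q) + 2 * (P * Q)                ≤⟨ +-monoʳ-≤ (2 * (P * Q)) (2*m*n≤m*m+n*n P Q) ⟩
  2 * (P * Q) + (P * P + Q * Q)            ≡⟨ e₃ P Q ⟩
  (P + Q) * (P + Q)                        ∎)
  where
  open ≤-Reasoning
  P = x * x * Y
  Q = X * (y * y)
  e₁ : ∀ x y a → 2 * (x * y * a) * (2 * (x * y * a)) ≡ 4 * (x * x * (y * y)) * (a * a)
  e₁ = solve-∀
  e₂ : ∀ x y X Y → 4 * (x * x * (y * y)) * (X * Y) ≡ 2 * (x * x * Y * (X * (y * y))) + 2 * (x * x * Y * (X * (y * y)))
  e₂ = solve-∀
  e₃ : ∀ P Q → 2 * (P * Q) + (P * P + Q * Q) ≡ (P + Q) * (P + Q)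
  e₃ = solve-∀

cauchy-schwarz : {A : Set} (L : List A) (u v : A → ℕ)
  → ∑[ k ∈ L ] (u k * v k) * ∑[ k ∈ L ] (u k * v k) ≤ ∑[ k ∈ L ] (u k * u k) * ∑[ k ∈ L ] (v k * v k)
cauchy-schwarz []      u v = z≤n
cauchy-schwarz (k ∷ L) u v = begin
  (x * y + a) * (x * y + a)
    ≡⟨ e₁ x y a ⟩
  x * y * (x * y) + 2 * (x * y * a) + a * a
    ≤⟨ +-mono-≤ (+-monoʳ-≤ (x * y * (x * y)) (cross-term-≤ x y a X Y ih)) ih ⟩
  x * y * (x * y) + (x * x * Y + X * (y * y)) + X * Y
    ≡⟨ e₂ x y X Y ⟩
  (x * x + X) * (y * y + Y) ∎
  where
  open ≤-Reasoning
  x = u k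
  y = v k
  a = ∑[ k ∈ L ] (u k * v k)
  X = ∑[ k ∈ L ] (u k * u k)
  Y = ∑[ k ∈ L ] (v k * v k)
  ih = cauchy-schwarz L u v
  e₁ : ∀ x y a → (x * y + a) * (x * y + a) ≡ x * y * (x * y) + 2 * (x * y * a) + a * a
  e₁ = solve-∀
  e₂ : ∀ x y X Y → x * y * (x * y) + (x * x * Y + X * (y * y)) + X * Y ≡ (x * x + X) * (y * y + Y)
  e₂ = solve-∀

∑-square≤square-∑ : {A : Set} (L : List A) (y : A → ℕ) → ∑[ x ∈ L ] (y x * y x) ≤ ∑ L y * ∑ L y
∑-square≤square-∑ []      y = z≤n
∑-square≤square-∑ (x ∷ L) y = begin
  y x * y x + ∑[ z ∈ L ] (y z * y z)      ≤⟨ +-monoʳ-≤ (y x * y x) (∑-square≤square-∑ L y) ⟩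
  y x * y x + S * S                       ≤⟨ +-monoʳ-≤ (y x * y x) (m≤n+m (S * S) (2 * (y x * S))) ⟩
  y x * y x + (2 * (y x * S) + S * S)     ≡⟨ e (y x) S ⟩
  (y x + S) * (y x + S)                   ∎
  where
  open ≤-Reasoning
  S = ∑ L y
  e : ∀ a S → a * a + (2 * (a * S) + S * S) ≡ (a + S) * (a + S)
  e = solve-∀

module FunctionSums (m : ℕ) where

  Fn : ℕ → Set
  Fn N = Fin N → Fin m

  ∑all : (N : ℕ) → (Fn N → ℕ) → ℕ
  ∑all N = ∑ (allFuns N m)

  -- Without function extensionality, reindexing a sum over functions needs this.
  Resp : {N : ℕ} → (Fn N → ℕ) → Set
  Resp w = ∀ {f f'} → f ≗ f' → w f ≡ w f'

  AgreeOff : {N : ℕ} → Subset N → Fn N → Fn N → Set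
  AgreeOff M f g = ∀ v → v ∉ M → f v ≡ g v

  AgreeOn : {N : ℕ} → Subset N → Fn N → Fn N → Set
  AgreeOn M f g = ∀ v → v ∈ M → f v ≡ g v

  DependsOff : {N : ℕ} → Subset N → (Fn N → ℕ) → Set
  DependsOff M w = ∀ f f' → AgreeOff M f f' → w f ≡ w f'

  agreeOff? : {N : ℕ} (M : Subset N) (f g : Fn N) → Dec (AgreeOff M f g)
  agreeOff? M f g = all? (λ v → ¬? (v ∈? M) →-dec (f v ≟ g v))

  -- The functions that agree with g off M.
  variations : {N : ℕ} → Subset N → Fn N → List (Fn N)
  variations {zero}  []          g = allFuns zero m
  variations {suc N} (true ∷ M)  g = concatMap (λ a → map (a ◂_) (variations M (tail g))) (allFin m)
  variations {suc N} (false ∷ M) g = map (head g ◂_) (variations M (tail g))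

  ∑var : {N : ℕ} → Subset N → Fn N → (Fn N → ℕ) → ℕ
  ∑var M g = ∑ (variations M g)

  agreeOff-inside : ∀ {N} {M : Subset N} {f g} (a : Fin m) → AgreeOff M f (tail g) → AgreeOff (true ∷ M) (a ◂ f) g
  agreeOff-inside a f~g zero    0∉ = ⊥-elim (0∉ here)
  agreeOff-inside a f~g (suc v) v∉ = f~g v (v∉ ∘ there)

  agreeOff-outside : ∀ {N} {M : Subset N} {f g} {a : Fin m} → a ≡ head g → AgreeOff M f (tail g)
                   → AgreeOff (false ∷ M) (a ◂ f) g
  agreeOff-outside a≡g₀ f~g zero    _  = a≡g₀
  agreeOff-outside a≡g₀ f~g (suc v) v∉ = f~g v (v∉ ∘ there)

  agreeOff-tail : ∀ {N} {b} {M : Subset N} {f g} {a : Fin m} → AgreeOff (b ∷ M) (a ◂ f) g → AgreeOff M f (tail g)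
  agreeOff-tail a◂f~g v v∉ = a◂f~g (suc v) (λ { (there v∈) → v∉ v∈ })

  ∑all-suc : (N : ℕ) (w : Fn (suc N) → ℕ) → ∑all (suc N) w ≡ ∑[ a ∈ allFin m ] ∑all N (λ f → w (a ◂ f))
  ∑all-suc N w = trans (∑-concatMap _ (allFin m) w) (∑-cong (allFin m) (λ a → ∑-map (a ◂_) (allFuns N m) w))

  ∑var-inside : {N : ℕ} (M : Subset N) (g : Fn (suc N)) (w : Fn (suc N) → ℕ)
              → ∑var (true ∷ M) g w ≡ ∑[ a ∈ allFin m ] ∑var M (tail g) (λ f → w (a ◂ f))
  ∑var-inside M g w = trans (∑-concatMap _ (allFin m) w)
                            (∑-cong (allFin m) (λ a → ∑-map (a ◂_) (variations M (tail g)) w))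

  ∑var-outside : {N : ℕ} (M : Subset N) (g : Fn (suc N)) (w : Fn (suc N) → ℕ)
               → ∑var (false ∷ M) g w ≡ ∑var M (tail g) (λ f → w (head g ◂ f))
  ∑var-outside M g w = ∑-map _ (variations M (tail g)) w

  variations-agree : {N : ℕ} (M : Subset N) (g : Fn N) → All (λ f → AgreeOff M f g) (variations M g)
  variations-agree {zero}  []          g = (λ ()) ∷ []
  variations-agree {suc N} (true ∷ M)  g = concatMap-agree (allFin m)
    where
    concatMap-agree : (L : List (Fin m))
                    → All (λ f → AgreeOff (true ∷ M) f g) (concatMap (λ a → map (a ◂_) (variations M (tail g))) L)
    concatMap-agree []      = []
    concatMap-agree (a ∷ L) =
      ++⁺ (map⁺ (All.map (agreeOff-inside a) (variations-agree M (tail g)))) (concatMap-agree L)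
  variations-agree {suc N} (false ∷ M) g = map⁺ (All.map (agreeOff-outside refl) (variations-agree M (tail g)))

  ∑var-cong : {N : ℕ} (M : Subset N) (g : Fn N) {w w' : Fn N → ℕ}
            → (∀ f → AgreeOff M f g → w f ≡ w' f) → ∑var M g w ≡ ∑var M g w'
  ∑var-cong M g w≗w' = ∑-cong-All (All.map (w≗w' _) (variations-agree M g))

  ∑var-cong₂ : {N : ℕ} (M : Subset N) (g g' : Fn N) {w w' : Fn N → ℕ}
             → (∀ f f' → AgreeOff M f g → AgreeOff M f' g' → AgreeOn M f f' → w f ≡ w' f')
             → ∑var M g w ≡ ∑var M g' w'
  ∑var-cong₂ {zero}  []          g g' match = cong (_+ 0) (match _ _ (λ ()) (λ ()) (λ ()))
  ∑var-cong₂ {suc N} (true ∷ M)  g g' {w} {w'} match = begin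
    ∑var (true ∷ M) g w                                    ≡⟨ ∑var-inside M g w ⟩
    ∑[ a ∈ allFin m ] ∑var M (tail g) (λ f → w (a ◂ f))
      ≡⟨ ∑-cong (allFin m) (λ a → ∑var-cong₂ M (tail g) (tail g') (match-suc a)) ⟩
    ∑[ a ∈ allFin m ] ∑var M (tail g') (λ f → w' (a ◂ f))  ≡⟨ ∑var-inside M g' w' ⟨
    ∑var (true ∷ M) g' w'                                  ∎
    where
    open ≡-Reasoning
    match-suc : ∀ a f f' → AgreeOff M f (tail g) → AgreeOff M f' (tail g') → AgreeOn M f f' → w (a ◂ f) ≡ w' (a ◂ f')
    match-suc a f f' f~g f'~g' on = match (a ◂ f) (a ◂ f') (agreeOff-inside a f~g) (agreeOff-inside a f'~g')
      (λ { zero _ → refl ; (suc v) (there v∈) → on v v∈ })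
  ∑var-cong₂ {suc N} (false ∷ M) g g' {w} {w'} match =
    trans (∑var-outside M g w) (trans (∑var-cong₂ M (tail g) (tail g') match-suc) (sym (∑var-outside M g' w')))
    where
    match-suc : ∀ f f' → AgreeOff M f (tail g) → AgreeOff M f' (tail g') → AgreeOn M f f'
              → w (head g ◂ f) ≡ w' (head g' ◂ f')
    match-suc f f' f~g f'~g' on = match (head g ◂ f) (head g' ◂ f') (agreeOff-outside refl f~g) (agreeOff-outside refl f'~g')
      (λ { (suc v) (there v∈) → on v v∈ })

  Disjoint : {N : ℕ} → Subset N → Subset N → Set
  Disjoint M₁ M₂ = ∀ v → v ∈ M₁ → v ∉ M₂

  Disjoint-tail : ∀ {N} {x y} {M₁ M₂ : Subset N} → Disjoint (x ∷ M₁) (y ∷ M₂) → Disjoint M₁ M₂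
  Disjoint-tail d v v∈₁ v∈₂ = d (suc v) (there v∈₁) (there v∈₂)

  ∑var-∪ : {N : ℕ} (M₁ M₂ : Subset N) (g : Fn N) (w : Fn N → ℕ) → Disjoint M₁ M₂
         → ∑var (M₁ ∪ M₂) g w ≡ ∑var M₁ g (λ f → ∑var M₂ f w)
  ∑var-∪ {zero}  []           []           g w _ = sym (+-identityʳ _)
  ∑var-∪ {suc N} (true ∷ M₁)  (true ∷ M₂)  g w d = ⊥-elim (d zero here here)
  ∑var-∪ {suc N} (true ∷ M₁)  (false ∷ M₂) g w d =
    trans (∑var-inside (M₁ ∪ M₂) g w) (trans (∑-cong (allFin m) (λ a →
      trans (∑var-∪ M₁ M₂ (tail g) _ (Disjoint-tail d))
            (∑var-cong M₁ (tail g) (λ f _ → sym (∑var-outside M₂ (a ◂ f) w)))))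
      (sym (∑var-inside M₁ g _)))
  ∑var-∪ {suc N} (false ∷ M₁) (true ∷ M₂)  g w d =
    trans (∑var-inside (M₁ ∪ M₂) g w) (trans (∑-cong (allFin m) (λ a → ∑var-∪ M₁ M₂ (tail g) _ (Disjoint-tail d)))
      (trans (∑-comm (allFin m) (variations M₁ (tail g)) _)
        (trans (∑var-cong M₁ (tail g) (λ f _ → sym (∑var-inside M₂ (head g ◂ f) w))) (sym (∑var-outside M₁ g _)))))
  ∑var-∪ {suc N} (false ∷ M₁) (false ∷ M₂) g w d =
    trans (∑var-outside (M₁ ∪ M₂) g w) (trans (∑var-∪ M₁ M₂ (tail g) _ (Disjoint-tail d))
      (trans (∑var-cong M₁ (tail g) (λ f _ → sym (∑var-outside M₂ (head g ◂ f) w))) (sym (∑var-outside M₁ g _))))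

  ∑var-⊤ : {N : ℕ} (g : Fn N) (w : Fn N → ℕ) → ∑var ⊤ g w ≡ ∑all N w
  ∑var-⊤ {zero}  g w = refl
  ∑var-⊤ {suc N} g w =
    trans (∑var-inside ⊤ g w) (trans (∑-cong (allFin m) (λ a → ∑var-⊤ (tail g) _)) (sym (∑all-suc N w)))

  ∑var-as-∑all : {N : ℕ} (M : Subset N) (g : Fn N) (w : Fn N → ℕ)
               → ∑var M g w ≡ ∑all N (λ f → ind (agreeOff? M f g) * w f)
  ∑var-as-∑all {zero}  []          g w =
    ∑-cong (allFuns zero m) (λ f → sym (trans (cong (_* w f) (ind-yes (agreeOff? {zero} [] f g) (λ ()))) (+-identityʳ (w f))))
  ∑var-as-∑all {suc N} (true ∷ M)  g w = begin
    ∑var (true ∷ M) g w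
      ≡⟨ ∑var-inside M g w ⟩
    ∑[ a ∈ allFin m ] ∑var M (tail g) (λ f → w (a ◂ f))
      ≡⟨ ∑-cong (allFin m) (λ a → ∑var-as-∑all M (tail g) _) ⟩
    ∑[ a ∈ allFin m ] ∑all N (λ f → ind (agreeOff? M f (tail g)) * w (a ◂ f))
      ≡⟨ ∑-cong (allFin m) (λ a → ∑-cong (allFuns N m) (λ f → cong (_* w (a ◂ f))
           (ind-cong (agreeOff? M f (tail g)) (agreeOff? (true ∷ M) (a ◂ f) g) (agreeOff-inside a) agreeOff-tail))) ⟩
    ∑[ a ∈ allFin m ] ∑all N (λ f → ind (agreeOff? (true ∷ M) (a ◂ f) g) * w (a ◂ f))
      ≡⟨ ∑all-suc N _ ⟨
    ∑all (suc N) (λ f → ind (agreeOff? (true ∷ M) f g) * w f) ∎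
    where open ≡-Reasoning
  ∑var-as-∑all {suc N} (false ∷ M) g w = begin
    ∑var (false ∷ M) g w
      ≡⟨ ∑var-outside M g w ⟩
    ∑var M (tail g) (λ f → w (head g ◂ f))
      ≡⟨ ∑var-as-∑all M (tail g) _ ⟩
    X (head g)
      ≡⟨ ∑-point (head g) X ⟨
    ∑[ a ∈ allFin m ] (ind (a ≟ head g) * X a)
      ≡⟨ ∑-cong (allFin m) (λ a → *-distribˡ-∑ (allFuns N m) (ind (a ≟ head g)) _) ⟩
    ∑[ a ∈ allFin m ] ∑all N (λ f → ind (a ≟ head g) * (ind (agreeOff? M f (tail g)) * w (a ◂ f)))
      ≡⟨ ∑-cong (allFin m) (λ a → ∑-cong (allFuns N m) (λ f → indicator a f)) ⟩
    ∑[ a ∈ allFin m ] ∑all N (λ f → ind (agreeOff? (false ∷ M) (a ◂ f) g) * w (a ◂ f))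
      ≡⟨ ∑all-suc N _ ⟨
    ∑all (suc N) (λ f → ind (agreeOff? (false ∷ M) f g) * w f) ∎
    where
    open ≡-Reasoning
    X : Fin m → ℕ
    X a = ∑all N (λ f → ind (agreeOff? M f (tail g)) * w (a ◂ f))
    indicator : ∀ a f → ind (a ≟ head g) * (ind (agreeOff? M f (tail g)) * w (a ◂ f))
                      ≡ ind (agreeOff? (false ∷ M) (a ◂ f) g) * w (a ◂ f)
    indicator a f = trans (sym (*-assoc (ind (a ≟ head g)) _ _)) (cong (_* w (a ◂ f))
      (trans (sym (ind-× (a ≟ head g) (agreeOff? M f (tail g))))
             (ind-cong ((a ≟ head g) ×-dec agreeOff? M f (tail g)) (agreeOff? (false ∷ M) (a ◂ f) g)
                      (uncurry agreeOff-outside) (λ a◂f~g → a◂f~g zero (λ ()) , agreeOff-tail a◂f~g))))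

  insertAt-cong : {N : ℕ} {f f' : Fn N} (j : Fin (suc N)) (a : Fin m) → f ≗ f' → insertAt f j a ≗ insertAt f' j a
  insertAt-cong         zero    a f≗f' zero    = refl
  insertAt-cong         zero    a f≗f' (suc v) = f≗f' v
  insertAt-cong {suc N} (suc j) a f≗f' zero    = f≗f' zero
  insertAt-cong {suc N} (suc j) a f≗f' (suc v) = insertAt-cong j a (f≗f' ∘ suc) v

  insertAt-zero : {N : ℕ} (f : Fn N) (a : Fin m) → (a ◂ f) ≗ insertAt f zero a
  insertAt-zero f a zero    = refl
  insertAt-zero f a (suc v) = refl

  insertAt-suc : {N : ℕ} (f : Fn (suc N)) (j : Fin (suc N)) (a : Fin m)
               → (head f ◂ insertAt (tail f) j a) ≗ insertAt f (suc j) a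
  insertAt-suc f j a zero    = refl
  insertAt-suc f j a (suc v) = refl

  ∑all-insertAt : (N : ℕ) (j : Fin (suc N)) (w : Fn (suc N) → ℕ) → Resp w
                → ∑all (suc N) w ≡ ∑[ a ∈ allFin m ] ∑all N (λ f → w (insertAt f j a))
  ∑all-insertAt N       zero    w resp =
    trans (∑all-suc N w) (∑-cong (allFin m) (λ a → ∑-cong (allFuns N m) (λ f →
      resp (insertAt-zero f a))))
  ∑all-insertAt (suc N) (suc j) w resp =
    trans (∑all-suc (suc N) w) (trans (∑-cong (allFin m) (λ b →
      ∑all-insertAt N j (λ f → w (b ◂ f)) (λ f≗f' → resp λ { zero → refl ; (suc v) → f≗f' v })))
      (trans (∑-comm (allFin m) (allFin m) _) (∑-cong (allFin m) (λ a →
        trans (sym (∑all-suc N _)) (∑-cong (allFuns (suc N) m) (λ f → resp (insertAt-suc f j a)))))))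

  -- Peel off the coordinate π⁻¹(0); the others are then permuted by remove (π⁻¹(0)) π.
  ∑all-permute : (N : ℕ) (π : Permutation N N) (w : Fn N → ℕ) → Resp w
               → ∑all N w ≡ ∑all N (λ f → w (f ∘ (π ⟨$⟩ʳ_)))
  ∑all-permute zero    π w resp = cong (_+ 0) (resp (λ ()))
  ∑all-permute (suc N) π w resp =
    trans (∑all-insertAt N j w resp) (trans (∑-cong (allFin m) (λ a →
      trans (∑all-permute N σ (λ f → w (insertAt f j a)) (resp ∘ insertAt-cong j a))
            (∑-cong (allFuns N m) (λ f → resp (insert-σ≗◂-π a f)))))
      (sym (∑all-suc N _)))
    where
    j = π ⟨$⟩ˡ zero
    σ = remove j π
    insert-σ≗◂-π : ∀ a f → insertAt (f ∘ (σ ⟨$⟩ʳ_)) j a ≗ (a ◂ f) ∘ (π ⟨$⟩ʳ_)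
    insert-σ≗◂-π a f v with j ≟ v
    ... | yes refl = trans (insertAt-lookup _ j a) (sym (cong (a ◂ f) (inverseʳ π)))
    ... | no  j≢v  = subst (λ v → insertAt (f ∘ (σ ⟨$⟩ʳ_)) j a v ≡ (a ◂ f) (π ⟨$⟩ʳ v)) (punchIn-punchOut j≢v)
           (trans (insertAt-punchIn _ j a (punchOut j≢v))
             (sym (trans (cong (a ◂ f) (punchIn-permute π j (punchOut j≢v)))
                         (cong (λ z → (a ◂ f) (punchIn z (σ ⟨$⟩ʳ punchOut j≢v))) (inverseʳ π)))))

  ∑all-split : {N : ℕ} (A B : Subset N) → Disjoint A B → (g₀ : Fn N) (u v : Fn N → ℕ)
             → DependsOff B u → DependsOff A v
             → ∑all N (λ f → u f * v f) ≡ ∑var (∁ (A ∪ B)) g₀ (λ g → ∑var A g u * ∑var B g v)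
  ∑all-split {N} A B A∩B=∅ g₀ u v u-off-B v-off-A = begin
    ∑all N (λ f → u f * v f)                                   ≡⟨ ∑var-⊤ g₀ _ ⟨
    ∑var ⊤ g₀ (λ f → u f * v f)                                ≡⟨ cong (λ M → ∑var M g₀ (λ f → u f * v f)) ⊤≡F∪A∪B ⟩
    ∑var (F ∪ (A ∪ B)) g₀ (λ f → u f * v f)                    ≡⟨ ∑var-∪ F (A ∪ B) g₀ _ (λ x x∈F → x∈∁p⇒x∉p x∈F) ⟩
    ∑var F g₀ (λ g → ∑var (A ∪ B) g (λ f → u f * v f))         ≡⟨ ∑var-cong F g₀ (λ g _ → ∑var-∪ A B g _ A∩B=∅) ⟩
    ∑var F g₀ (λ g → ∑var A g (λ g' → ∑var B g' (λ f → u f * v f)))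
      ≡⟨ ∑var-cong F g₀ (λ g _ → ∑var-cong A g (λ g' g'~g → factor g g' g'~g)) ⟩
    ∑var F g₀ (λ g → ∑var A g (λ g' → u g' * ∑var B g v))      ≡⟨ ∑var-cong F g₀ (λ g _ → sym (*-distribʳ-∑ (variations A g) _ u)) ⟩
    ∑var F g₀ (λ g → ∑var A g u * ∑var B g v)                  ∎
    where
    open ≡-Reasoning
    F = ∁ (A ∪ B)
    ⊤≡F∪A∪B : ⊤ ≡ F ∪ (A ∪ B)
    ⊤≡F∪A∪B = trans (sym (p∪∁p≡⊤ (A ∪ B))) (∪-comm (A ∪ B) F)
    factor : ∀ g g' → AgreeOff A g' g → ∑var B g' (λ f → u f * v f) ≡ u g' * ∑var B g v
    factor g g' g'~g = begin
      ∑var B g' (λ f → u f * v f)    ≡⟨ ∑var-cong B g' (λ f f~g' → cong (_* v f) (u-off-B f g' f~g')) ⟩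
      ∑var B g' (λ f → u g' * v f)   ≡⟨ *-distribˡ-∑ (variations B g') (u g') v ⟨
      u g' * ∑var B g' v             ≡⟨ cong (u g' *_) (∑var-cong₂ B g' g (λ f f' f~g' f'~g on →
                                          v-off-A f f' (off-A f f' f~g' f'~g on))) ⟩
      u g' * ∑var B g v              ∎
      where
      off-A : ∀ f f' → AgreeOff B f g' → AgreeOff B f' g → AgreeOn B f f' → AgreeOff A f f'
      off-A f f' f~g' f'~g on x x∉A with x ∈? B
      ... | yes x∈B = on x x∈B
      ... | no  x∉B = trans (f~g' x x∉B) (trans (g'~g x x∉A) (sym (f'~g x x∉B)))

  agreeOff-resp : {N : ℕ} (M : Subset N) {f f' : Fn N} (g : Fn N) → f ≗ f' → AgreeOff M f g → AgreeOff M f' g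
  agreeOff-resp M g f≗f' ag v v∉ = trans (sym (f≗f' v)) (ag v v∉)

  ∑var-permute : {N : ℕ} (A B : Subset N) (π : Permutation N N)
               → (∀ v → v ∉ B → π ⟨$⟩ʳ v ∉ A) → (∀ u → u ∉ A → π ⟨$⟩ˡ u ∉ B)
               → (g : Fn N) (w : Fn N → ℕ) → Resp w
               → ∑var B g w ≡ ∑var A (g ∘ (π ⟨$⟩ˡ_)) (λ f → w (f ∘ (π ⟨$⟩ʳ_)))
  ∑var-permute {N} A B π π[∁B]⊆∁A π⁻¹[∁A]⊆∁B g w resp = begin
    ∑var B g w
      ≡⟨ ∑var-as-∑all B g w ⟩
    ∑all N (λ f → ind (agreeOff? B f g) * w f)
      ≡⟨ ∑all-permute N π _ (λ f≗f' → cong₂ _*_ (ind-cong (agreeOff? B _ g) (agreeOff? B _ g)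
            (agreeOff-resp B g f≗f') (agreeOff-resp B g (sym ∘ f≗f'))) (resp f≗f')) ⟩
    ∑all N (λ f → ind (agreeOff? B (f ∘ (π ⟨$⟩ʳ_)) g) * w (f ∘ (π ⟨$⟩ʳ_)))
      ≡⟨ ∑-cong (allFuns N m) (λ f → cong (_* w (f ∘ (π ⟨$⟩ʳ_)))
            (ind-cong (agreeOff? B (f ∘ (π ⟨$⟩ʳ_)) g) (agreeOff? A f (g ∘ (π ⟨$⟩ˡ_))) (transport f) (transport⁻¹ f))) ⟩
    ∑all N (λ f → ind (agreeOff? A f (g ∘ (π ⟨$⟩ˡ_))) * w (f ∘ (π ⟨$⟩ʳ_)))
      ≡⟨ ∑var-as-∑all A (g ∘ (π ⟨$⟩ˡ_)) _ ⟨
    ∑var A (g ∘ (π ⟨$⟩ˡ_)) (λ f → w (f ∘ (π ⟨$⟩ʳ_))) ∎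
    where
    open ≡-Reasoning
    transport : ∀ f → AgreeOff B (f ∘ (π ⟨$⟩ʳ_)) g → AgreeOff A f (g ∘ (π ⟨$⟩ˡ_))
    transport f ag u u∉A = subst (λ z → f z ≡ g (π ⟨$⟩ˡ u)) (inverseʳ π) (ag (π ⟨$⟩ˡ u) (π⁻¹[∁A]⊆∁B u u∉A))
    transport⁻¹ : ∀ f → AgreeOff A f (g ∘ (π ⟨$⟩ˡ_)) → AgreeOff B (f ∘ (π ⟨$⟩ʳ_)) g
    transport⁻¹ f ag v v∉B = trans (ag (π ⟨$⟩ʳ v) (π[∁B]⊆∁A v v∉B)) (cong g (inverseˡ π))

allFuns-empty : ∀ {N m} → Fin N → m ≡ 0 → allFuns N m ≡ []
allFuns-empty {suc N} _ refl = refl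

module Counting (H G : Graph) where
  open FunctionSums (n G)

  HomOff : Subset (n H) → Fn (n H) → Set
  HomOff X f = ∀ i j → i ∉ X → j ∉ X → Edge H i j → Edge G (f i) (f j)

  homOff? : (X : Subset (n H)) (f : Fn (n H)) → Dec (HomOff X f)
  homOff? X f = all? λ i → all? λ j →
    ¬? (i ∈? X) →-dec (¬? (j ∈? X) →-dec ((adj H i j Bool.≟ true) →-dec (adj G (f i) (f j) Bool.≟ true)))

  SendsOff : Subset (n H) → Subset (n H) → V G → Fn (n H) → Set
  SendsOff X S w f = ∀ v → v ∈ S → v ∉ X → f v ≡ w

  sendsOff? : (X S : Subset (n H)) (w : V G) (f : Fn (n H)) → Dec (SendsOff X S w f)
  sendsOff? X S w f = all? λ v → (v ∈? S) →-dec (¬? (v ∈? X) →-dec (f v ≟ w))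

  -- The factor of [f is a homomorphism sending S to w] that only looks at vertices off X.
  side : Subset (n H) → Subset (n H) → V G → Fn (n H) → ℕ
  side X S w f = ind (homOff? X f) * ind (sendsOff? X S w f)

  homOff-dependsOff : (X : Subset (n H)) → DependsOff X (ind ∘ homOff? X)
  homOff-dependsOff X f f' f~f' = ind-cong (homOff? X f) (homOff? X f') (transfer f~f') (transfer (λ x x∉ → sym (f~f' x x∉)))
    where
    transfer : ∀ {f f'} → AgreeOff X f f' → HomOff X f → HomOff X f'
    transfer f~f' hom i j i∉ j∉ e = subst₂ (Edge G) (f~f' i i∉) (f~f' j j∉) (hom i j i∉ j∉ e)

  side-dependsOff : (X S : Subset (n H)) (w : V G) → DependsOff X (side X S w)
  side-dependsOff X S w f f' f~f' = cong₂ _*_ (homOff-dependsOff X f f' f~f')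
    (ind-cong (sendsOff? X S w f) (sendsOff? X S w f') (transfer f~f') (transfer (λ x x∉ → sym (f~f' x x∉))))
    where
    transfer : ∀ {f f'} → AgreeOff X f f' → SendsOff X S w f → SendsOff X S w f'
    transfer f~f' sends v v∈S v∉X = trans (sym (f~f' v v∉X)) (sends v v∈S v∉X)

  hom-as-∑all : hom H G ≡ ∑all (n H) (ind ∘ isHom? H G)
  hom-as-∑all = length-filter (isHom? H G) (allFuns (n H) (n G))

  homR-as-∑all : (S : Subset (n H)) → homR H G S ≡ ∑all (n H) (λ f → ind (isHom? H G f) * ind (collapses? H G S f))
  homR-as-∑all S = trans (length-filter (collapses? H G S) (filter (isHom? H G) (allFuns (n H) (n G))))
                         (∑-filter (isHom? H G) (allFuns (n H) (n G)) _)

  homR-cong : {S S' : Subset (n H)} → (∀ v → v ∈ S ⇔ v ∈ S') → homR H G S ≡ homR H G S'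
  homR-cong {S} {S'} S⇔S' = trans (homR-as-∑all S) (trans (∑-cong (allFuns (n H) (n G)) (λ f →
    cong (ind (isHom? H G f) *_) (ind-cong (collapses? H G S f) (collapses? H G S' f)
      (λ col i j i∈ j∈ → col i j (from (S⇔S' i) i∈) (from (S⇔S' j) j∈))
      (λ col i j i∈ j∈ → col i j (to (S⇔S' i) i∈) (to (S⇔S' j) j∈)))))
    (sym (homR-as-∑all S')))
    where open Equivalence

  homR-no-vertices : (S : Subset (n H)) → V H → n G ≡ 0 → homR H G S ≡ 0
  homR-no-vertices S r n≡0 = cong (λ L → length (filter (collapses? H G S) (filter (isHom? H G) L))) (allFuns-empty r n≡0)

  ∑-side≤homOff : (X S : Subset (n H)) {r : V H} → r ∈ S → r ∉ X → ∀ f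
                → ∑[ w ∈ allFin (n G) ] side X S w f ≤ ind (homOff? X f)
  ∑-side≤homOff X S {r} r∈S r∉X f = begin
    ∑[ w ∈ allFin (n G) ] side X S w f                       ≡⟨ *-distribˡ-∑ (allFin (n G)) (ind (homOff? X f)) _ ⟨
    ind (homOff? X f) * ∑[ w ∈ allFin (n G) ] ind (sendsOff? X S w f)
      ≤⟨ *-monoʳ-≤ (ind (homOff? X f)) (begin
           ∑[ w ∈ allFin (n G) ] ind (sendsOff? X S w f)
             ≤⟨ ∑-mono (allFin (n G)) (λ w → subst (ind (sendsOff? X S w f) ≤_) (sym (*-identityʳ _))
                  (ind-mono (sendsOff? X S w f) (w ≟ f r) (λ sends → sym (sends r r∈S r∉X)))) ⟩
           ∑[ w ∈ allFin (n G) ] (ind (w ≟ f r) * 1)   ≡⟨ ∑-point (f r) (λ _ → 1) ⟩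
           1                                            ∎) ⟩
    ind (homOff? X f) * 1                                     ≡⟨ *-identityʳ _ ⟩
    ind (homOff? X f)                                         ∎
    where open ≤-Reasoning

module Reflection (H G : Graph) {A B : Subset (n H)} {φ : Automorphism H} (nice : Nice H A B φ) where
  open FunctionSums (n G)
  open Counting H G
  open Nice nice

  φ-involutive : ∀ v → to φ (to φ v) ≡ v
  φ-involutive v = trans (cong (to φ) (self-inverse v)) (to-from φ v)

  B⊆∁A : ∀ {v} → v ∈ B → v ∉ A
  B⊆∁A v∈B v∈A = disjAB _ v∈A v∈B

  φ[B]⊆A : ∀ {v} → v ∈ B → to φ v ∈ A
  φ[B]⊆A {v} v∈B with B⊆imageA v v∈B
  ... | u , u∈A , refl = subst (_∈ A) (sym (φ-involutive u)) u∈A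

  φ[∁B]⊆∁A : ∀ {v} → v ∉ B → to φ v ∉ A
  φ[∁B]⊆∁A {v} v∉B φv∈A = v∉B (subst (_∈ B) (φ-involutive v) (imageA⊆B _ φv∈A))

  φ[∁A]⊆∁B : ∀ {v} → v ∉ A → to φ v ∉ B
  φ[∁A]⊆∁B {v} v∉A φv∈B = v∉A (subst (_∈ A) (φ-involutive v) (φ[B]⊆A φv∈B))

  φ-edge : ∀ {i j} → Edge H i j → Edge H (to φ i) (to φ j)
  φ-edge {i} {j} e = trans (pres φ i j) e

  isHom⇔homOff : ∀ f → IsHom H G f ⇔ (HomOff B f × HomOff A f)
  isHom⇔homOff f = mk⇔ (λ hom → (λ i j _ _ → hom i j) , (λ i j _ _ → hom i j)) (uncurry glue)
    where
    glue : HomOff B f → HomOff A f → IsHom H G f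
    glue homB homA i j e with i ∈? B | j ∈? B
    ... | no i∉B  | no j∉B  = homB i j i∉B j∉B e
    ... | yes i∈B | _       = homA i j (B⊆∁A i∈B) (λ j∈A → separates j i j∈A i∈B (trans (Graph.sym H j i) e)) e
    ... | no i∉B  | yes j∈B = homA i j (λ i∈A → separates i j i∈A j∈B e) (B⊆∁A j∈B) e

  homOff-A-∘φ : ∀ f → ind (homOff? A (f ∘ to φ)) ≡ ind (homOff? B f)
  homOff-A-∘φ f = ind-cong (homOff? A (f ∘ to φ)) (homOff? B f) back forth
    where
    back : HomOff A (f ∘ to φ) → HomOff B f
    back hom i j i∉B j∉B e = subst₂ (λ a b → Edge G (f a) (f b)) (φ-involutive i) (φ-involutive j)
      (hom (to φ i) (to φ j) (φ[∁B]⊆∁A i∉B) (φ[∁B]⊆∁A j∉B) (φ-edge e))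
    forth : HomOff B f → HomOff A (f ∘ to φ)
    forth hom i j i∉A j∉A e = hom (to φ i) (to φ j) (φ[∁A]⊆∁B i∉A) (φ[∁A]⊆∁B j∉A) (φ-edge e)

  hom-split : hom H G ≡ ∑all (n H) (λ f → ind (homOff? B f) * ind (homOff? A f))
  hom-split = trans hom-as-∑all (∑-cong (allFuns (n H) (n G)) (λ f →
    trans (ind-cong (isHom? H G f) (homOff? B f ×-dec homOff? A f) (to (isHom⇔homOff f)) (from (isHom⇔homOff f)))
          (ind-× (homOff? B f) (homOff? A f))))
    where open Equivalence

  -- Split f by the common value w it gives to S; r ∈ S makes w unique.
  collapses-split : (S : Subset (n H)) {r : V H} → r ∈ S → ∀ f
    → ind (isHom? H G f) * ind (collapses? H G S f) ≡ ∑[ w ∈ allFin (n G) ] (side B S w f * side A S w f)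
  collapses-split S {r} r∈S f = begin
    ind hom? * ind col?
      ≡⟨ cong (ind hom? *_) (∑-point (f r) (λ _ → ind col?)) ⟨
    ind hom? * ∑[ w ∈ allFin (n G) ] (ind (w ≟ f r) * ind col?)
      ≡⟨ *-distribˡ-∑ (allFin (n G)) (ind hom?) _ ⟩
    ∑[ w ∈ allFin (n G) ] (ind hom? * (ind (w ≟ f r) * ind col?))
      ≡⟨ ∑-cong (allFin (n G)) (λ w → trans (cong (ind hom? *_) (sym (ind-× (w ≟ f r) col?))) (sym (ind-× hom? _))) ⟩
    ∑[ w ∈ allFin (n G) ] ind (hom? ×-dec ((w ≟ f r) ×-dec col?))
      ≡⟨ ∑-cong (allFin (n G)) (λ w → ind-cong _ (sides? w) (split w) (unsplit w)) ⟩
    ∑[ w ∈ allFin (n G) ] ind (sides? w)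
      ≡⟨ ∑-cong (allFin (n G)) (λ w → trans (ind-× (side? B w) (side? A w))
                                            (cong₂ _*_ (ind-× (homOff? B f) _) (ind-× (homOff? A f) _))) ⟩
    ∑[ w ∈ allFin (n G) ] (side B S w f * side A S w f) ∎
    where
    open ≡-Reasoning
    hom? = isHom? H G f
    col? = collapses? H G S f
    side? : ∀ X w → Dec (HomOff X f × SendsOff X S w f)
    side? X w = homOff? X f ×-dec sendsOff? X S w f
    sides? : ∀ w → Dec ((HomOff B f × SendsOff B S w f) × (HomOff A f × SendsOff A S w f))
    sides? w = side? B w ×-dec side? A w
    split : ∀ w → IsHom H G f × (w ≡ f r × Collapses H G S f)
          → (HomOff B f × SendsOff B S w f) × (HomOff A f × SendsOff A S w f)
    split w (hom , w≡fr , col) = let (homB , homA) = Equivalence.to (isHom⇔homOff f) hom in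
      (homB , λ v v∈S _ → trans (col v r v∈S r∈S) (sym w≡fr)) , (homA , λ v v∈S _ → trans (col v r v∈S r∈S) (sym w≡fr))
    unsplit : ∀ w → (HomOff B f × SendsOff B S w f) × (HomOff A f × SendsOff A S w f)
            → IsHom H G f × (w ≡ f r × Collapses H G S f)
    unsplit w ((homB , sendsB) , (homA , sendsA)) =
      Equivalence.from (isHom⇔homOff f) (homB , homA) , sym (sends r r∈S) , (λ i j i∈S j∈S → trans (sends i i∈S) (sym (sends j j∈S)))
      where
      sends : ∀ v → v ∈ S → f v ≡ w
      sends v v∈S with v ∈? A
      ... | yes v∈A = sendsB v v∈S (λ v∈B → disjAB v v∈A v∈B)
      ... | no  v∉A = sendsA v v∈S v∉A

  homR-split : (S : Subset (n H)) {r : V H} → r ∈ S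
             → homR H G S ≡ ∑[ w ∈ allFin (n G) ] ∑all (n H) (λ f → side B S w f * side A S w f)
  homR-split S r∈S = trans (homR-as-∑all S)
    (trans (∑-cong (allFuns (n H) (n G)) (collapses-split S r∈S)) (∑-comm (allFuns (n H) (n G)) (allFin (n G)) _))

  module WithBasePoint (c : V G) where

    g₀ : Fn (n H)
    g₀ _ = c

    -- F_φ, since A, B and F_φ partition V(H).
    F : Subset (n H)
    F = ∁ (A ∪ B)

    φ-permutation : Permutation (n H) (n H)
    φ-permutation = permutation (to φ) (from φ) (to-from φ) (from-to φ)

    -- For g constant on A ∪ B, the maps g ∘ φ and g agree off A.
    reflect : (w : Fn (n H) → ℕ) → DependsOff A w → (g : Fn (n H)) → AgreeOff F g g₀
            → ∑var B g w ≡ ∑var A g (λ f → w (f ∘ to φ))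
    reflect w w-off-A g g~g₀ =
      trans (∑var-permute A B φ-permutation (λ _ → φ[∁B]⊆∁A) φ⁻¹[∁A]⊆∁B g w (λ f≗f' → w-off-A _ _ (λ x _ → f≗f' x)))
            (∑var-cong₂ A (g ∘ from φ) g (λ f f' f~ f'~ on → w-off-A _ _ (λ x _ → glue f f' f~ f'~ on (to φ x))))
      where
      φ⁻¹[∁A]⊆∁B : ∀ u → u ∉ A → from φ u ∉ B
      φ⁻¹[∁A]⊆∁B u u∉A = subst (_∉ B) (self-inverse u) (φ[∁A]⊆∁B u∉A)
      A∪B⊆∁F : ∀ {x} → x ∈ A ⊎ x ∈ B → x ∉ F
      A∪B⊆∁F x∈A∪B x∈F = x∈∁p⇒x∉p x∈F (x∈p∪q⁺ x∈A∪B)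
      g∘φ~g : ∀ x → x ∉ A → g (from φ x) ≡ g x
      g∘φ~g x x∉A with covers x
      ... | inj₁ x∈A         = ⊥-elim (x∉A x∈A)
      ... | inj₂ (inj₁ x∈B)  = trans (g~g₀ (from φ x) (A∪B⊆∁F (inj₁ (subst (_∈ A) (self-inverse x) (φ[B]⊆A x∈B)))))
                                      (sym (g~g₀ x (A∪B⊆∁F (inj₂ x∈B))))
      ... | inj₂ (inj₂ fixed) = cong g (trans (sym (self-inverse x)) fixed)
      glue : ∀ f f' → AgreeOff A f (g ∘ from φ) → AgreeOff A f' g → AgreeOn A f f' → f ≗ f'
      glue f f' f~ f'~ on x with x ∈? A
      ... | yes x∈A = on x x∈A
      ... | no  x∉A = trans (f~ x x∉A) (trans (g∘φ~g x x∉A) (sym (f'~ x x∉A)))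

    module Step {R R' : Subset (n H)} (ψ : IsPsi H A B φ R R')
                {r₁ r₂ : V H} (r₁∈R : r₁ ∈ R) (r₁∈A∪F : r₁ ∈ A ⊎ Fixed φ r₁)
                (r₂∈R : r₂ ∈ R) (r₂∈B∪F : r₂ ∈ B ⊎ Fixed φ r₂) where

      open Equivalence

      r₂∉A : r₂ ∉ A
      r₂∉A r₂∈A = [ disjAB r₂ r₂∈A , disjAF r₂ r₂∈A ] r₂∈B∪F

      r₁∈R' : r₁ ∈ R'
      r₁∈R' = from (ψ r₁) (inj₁ (r₁∈R , r₁∈A∪F))

      side-B-ψ : ∀ w f → side B R' w f ≡ side B R w f
      side-B-ψ w f = cong (ind (homOff? B f) *_) (ind-cong (sendsOff? B R' w f) (sendsOff? B R w f) restrict extend)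
        where
        restrict : SendsOff B R' w f → SendsOff B R w f
        restrict sends u u∈R u∉B with covers u
        ... | inj₁ u∈A          = sends u (from (ψ u) (inj₁ (u∈R , inj₁ u∈A))) u∉B
        ... | inj₂ (inj₁ u∈B)   = ⊥-elim (u∉B u∈B)
        ... | inj₂ (inj₂ fixed) = sends u (from (ψ u) (inj₁ (u∈R , inj₂ fixed))) u∉B
        extend : SendsOff B R w f → SendsOff B R' w f
        extend sends v v∈R' v∉B with to (ψ v) v∈R'
        ... | inj₁ (v∈R , _)            = sends v v∈R v∉B
        ... | inj₂ (u , _ , u∈A , refl) = ⊥-elim (v∉B (imageA⊆B u u∈A))

      side-A-ψ-∘φ : ∀ w f → side A R' w (f ∘ to φ) ≡ side B R w f
      side-A-ψ-∘φ w f = cong₂ _*_ (homOff-A-∘φ f) (ind-cong (sendsOff? A R' w (f ∘ to φ)) (sendsOff? B R w f) back forth)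
        where
        back : SendsOff A R' w (f ∘ to φ) → SendsOff B R w f
        back sends u u∈R u∉B with covers u
        ... | inj₁ u∈A          = subst (λ z → f z ≡ w) (φ-involutive u)
                                    (sends (to φ u) (from (ψ _) (inj₂ (u , u∈R , u∈A , refl))) (B⊆∁A (imageA⊆B u u∈A)))
        ... | inj₂ (inj₁ u∈B)   = ⊥-elim (u∉B u∈B)
        ... | inj₂ (inj₂ fixed) = trans (cong f (sym fixed))
                                    (sends u (from (ψ u) (inj₁ (u∈R , inj₂ fixed))) (λ u∈A → disjAF u u∈A fixed))
        forth : SendsOff B R w f → SendsOff A R' w (f ∘ to φ)
        forth sends v v∈R' v∉A with to (ψ v) v∈R'
        ... | inj₁ (v∈R , inj₁ v∈A)     = ⊥-elim (v∉A v∈A)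
        ... | inj₁ (v∈R , inj₂ fixed)   = trans (cong f fixed) (sends v v∈R (λ v∈B → disjBF v v∈B fixed))
        ... | inj₂ (u , u∈R , u∈A , refl) = trans (cong f (φ-involutive u)) (sends u u∈R (λ u∈B → disjAB u u∈A u∈B))

      Pair : Set
      Pair = V G × Fn (n H)

      pairs : List Pair
      pairs = cartesianProduct (allFin (n G)) (variations F g₀)

      ∑-pairs : (h : V G → Fn (n H) → ℕ) → ∑ pairs (uncurry h) ≡ ∑[ w ∈ allFin (n G) ] ∑var F g₀ (h w)
      ∑-pairs = ∑-cartesianProduct (allFin (n G)) (variations F g₀)

      x y : Pair → ℕ
      x (w , g) = ∑var A g (side B R w)
      y (w , g) = ∑var B g (side A R w)

      homR-as-∑xy : homR H G R ≡ ∑[ p ∈ pairs ] (x p * y p)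
      homR-as-∑xy = trans (homR-split R r₁∈R) (trans (∑-cong (allFin (n G)) (λ w →
        ∑all-split A B disjAB g₀ (side B R w) (side A R w) (side-dependsOff B R w) (side-dependsOff A R w)))
        (sym (∑-pairs (λ w g → x (w , g) * y (w , g)))))

      homR'-as-∑xx : homR H G R' ≡ ∑[ p ∈ pairs ] (x p * x p)
      homR'-as-∑xx = trans (homR-split R' r₁∈R') (trans (∑-cong (allFin (n G)) (λ w →
        trans (∑all-split A B disjAB g₀ (side B R' w) (side A R' w) (side-dependsOff B R' w) (side-dependsOff A R' w))
          (∑var-cong F g₀ (λ g g~g₀ → cong₂ _*_ (∑var-cong A g (λ f _ → side-B-ψ w f)) (B-side≡x w g g~g₀)))))
        (sym (∑-pairs (λ w g → x (w , g) * x (w , g)))))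
        where
        B-side≡x : ∀ w g → AgreeOff F g g₀ → ∑var B g (side A R' w) ≡ x (w , g)
        B-side≡x w g g~g₀ = trans (reflect (side A R' w) (side-dependsOff A R' w) g g~g₀)
                                  (∑var-cong A g (λ f _ → side-A-ψ-∘φ w f))

      ∑-y≤homOff : ∀ g → ∑[ w ∈ allFin (n G) ] y (w , g) ≤ ∑var B g (ind ∘ homOff? A)
      ∑-y≤homOff g = subst (_≤ ∑var B g (ind ∘ homOff? A)) (sym (∑-comm (allFin (n G)) (variations B g) (λ w → side A R w)))
                       (∑-mono (variations B g) (∑-side≤homOff A R r₂∈R r₂∉A))

      ∑yy≤hom : ∑[ p ∈ pairs ] (y p * y p) ≤ hom H G
      ∑yy≤hom = begin
        ∑[ p ∈ pairs ] (y p * y p)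
          ≡⟨ ∑-pairs (λ w g → y (w , g) * y (w , g)) ⟩
        ∑[ w ∈ allFin (n G) ] ∑var F g₀ (λ g → y (w , g) * y (w , g))
          ≡⟨ ∑-comm (allFin (n G)) (variations F g₀) _ ⟩
        ∑var F g₀ (λ g → ∑[ w ∈ allFin (n G) ] (y (w , g) * y (w , g)))
          ≤⟨ ∑-mono (variations F g₀) (λ g → ∑-square≤square-∑ (allFin (n G)) (λ w → y (w , g))) ⟩
        ∑var F g₀ (λ g → ∑[ w ∈ allFin (n G) ] y (w , g) * ∑[ w ∈ allFin (n G) ] y (w , g))
          ≤⟨ ∑-mono (variations F g₀) (λ g → *-mono-≤ (∑-y≤homOff g) (∑-y≤homOff g)) ⟩
        ∑var F g₀ (λ g → homs-B g * homs-B g)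
          ≡⟨ ∑var-cong F g₀ (λ g g~g₀ → cong (_* homs-B g) (homs-B≡homs-A g g~g₀)) ⟩
        ∑var F g₀ (λ g → ∑var A g (ind ∘ homOff? B) * homs-B g)
          ≡⟨ ∑all-split A B disjAB g₀ _ _ (homOff-dependsOff B) (homOff-dependsOff A) ⟨
        ∑all (n H) (λ f → ind (homOff? B f) * ind (homOff? A f))
          ≡⟨ hom-split ⟨
        hom H G ∎
        where
        open ≤-Reasoning
        homs-B : Fn (n H) → ℕ
        homs-B g = ∑var B g (ind ∘ homOff? A)
        homs-B≡homs-A : ∀ g → AgreeOff F g g₀ → homs-B g ≡ ∑var A g (ind ∘ homOff? B)
        homs-B≡homs-A g g~g₀ = trans (reflect (ind ∘ homOff? A) (homOff-dependsOff A) g g~g₀)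
                                     (∑var-cong A g (λ f _ → homOff-A-∘φ f))

      homR-square≤ : homR H G R * homR H G R ≤ homR H G R' * hom H G
      homR-square≤ = begin
        homR H G R * homR H G R                                    ≡⟨ cong₂ _*_ homR-as-∑xy homR-as-∑xy ⟩
        ∑[ p ∈ pairs ] (x p * y p) * ∑[ p ∈ pairs ] (x p * y p)    ≤⟨ cauchy-schwarz pairs x y ⟩
        ∑[ p ∈ pairs ] (x p * x p) * ∑[ p ∈ pairs ] (y p * y p)    ≤⟨ *-mono-≤ (≤-reflexive (sym homR'-as-∑xx)) ∑yy≤hom ⟩
        homR H G R' * hom H G                                      ∎
        where open ≤-Reasoning

vertex-or-empty : (G : Graph) → V G ⊎ n G ≡ 0
vertex-or-empty G with n G
... | zero  = inj₂ refl
... | suc _ = inj₁ zero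

-- The reflection argument needs a vertex of G to enumerate maps from; without one, hom(H,G;R) = 0.
homR-square≤ : (H G : Graph) {A B : Subset (n H)} {φ : Automorphism H} → Nice H A B φ
  → {R R' : Subset (n H)} → IsPsi H A B φ R R'
  → {r₁ r₂ : V H} → r₁ ∈ R → r₁ ∈ A ⊎ Fixed φ r₁ → r₂ ∈ R → r₂ ∈ B ⊎ Fixed φ r₂
  → homR H G R * homR H G R ≤ homR H G R' * hom H G
homR-square≤ H G nice {R} ψ {r₁} r₁∈R r₁∈A∪F r₂∈R r₂∈B∪F with vertex-or-empty G
... | inj₁ c   = Reflection.WithBasePoint.Step.homR-square≤ H G nice c ψ r₁∈R r₁∈A∪F r₂∈R r₂∈B∪F
... | inj₂ n≡0 = subst (λ h → h * h ≤ _) (sym (Counting.homR-no-vertices H G R r₁ n≡0)) z≤n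

^-distribʳ-* : ∀ a b k → (a * b) ^ k ≡ a ^ k * b ^ k
^-distribʳ-* a b zero    = refl
^-distribʳ-* a b (suc k) = trans (cong (a * b *_) (^-distribʳ-* a b k)) (interchange a b (a ^ k) (b ^ k))
  where
  interchange : ∀ a b c d → a * b * (c * d) ≡ a * c * (b * d)
  interchange = solve-∀

square-then-power : ∀ a b x h k → a * a ≤ b * h → b ^ suc k ≤ x * h ^ k → a ^ (suc k + suc k) ≤ x * h ^ (k + suc k)
square-then-power a b x h k a²≤bh bound = begin
  a ^ (suc k + suc k)      ≡⟨ ^-distribˡ-+-* a (suc k) (suc k) ⟩
  a ^ suc k * a ^ suc k    ≡⟨ ^-distribʳ-* a a (suc k) ⟨
  (a * a) ^ suc k          ≤⟨ ^-monoˡ-≤ (suc k) a²≤bh ⟩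
  (b * h) ^ suc k          ≡⟨ ^-distribʳ-* b h (suc k) ⟩
  b ^ suc k * h ^ suc k    ≤⟨ *-monoˡ-≤ (h ^ suc k) bound ⟩
  x * h ^ k * h ^ suc k    ≡⟨ *-assoc x (h ^ k) (h ^ suc k) ⟩
  x * (h ^ k * h ^ suc k)  ≡⟨ cong (x *_) (^-distribˡ-+-* h k (suc k)) ⟨
  x * h ^ (k + suc k)      ∎
  where open ≤-Reasoning

module _ (H : Graph) (col : V H → Bool) (b : Bool) where

  X : Subset (n H)
  X = part H col b

  PowerBound : Subset (n H) → Set
  PowerBound R = ∃[ s ] (1 ≤ s × ((G : Graph) → homR H G R ^ s ≤ homR H G X * hom H G ^ (s ∸ 1)))

  reflChain⇒powerBound : {R : Subset (n H)} → ReflChain H col b R → PowerBound R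
  reflChain⇒powerBound (end R⇔X) = 1 , ≤-refl , λ G → ≤-reflexive (cong (_* 1) (Counting.homR-cong H G R⇔X))
  reflChain⇒powerBound {R} (step {R' = R'} A B φ nice (_ , (_ , r₁∈R , r₁∈A∪F) , (_ , r₂∈R , r₂∈B∪F)) ψ chain)
    with reflChain⇒powerBound chain
  ... | zero  , () , _
  ... | suc k , _  , bound = suc k + suc k , s≤s z≤n , λ G →
          square-then-power (homR H G R) (homR H G R') (homR H G X) (hom H G) k
            (homR-square≤ H G nice ψ r₁∈R r₁∈A∪F r₂∈R r₂∈B∪F) (bound G)

lemma2p14 : (H : Graph) (col : V H → Bool)
            → Connected H → ProperColouring H col → Reflective H col
            → (b : Bool) (R : Subset (n H)) → R ⊆ part H col b → ∣ R ∣ ≡ 2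
            → ∃[ s ] (1 ≤ s × ((G : Graph) →
                 homR H G R ^ s ≤ homR H G (part H col b) * hom H G ^ (s ∸ 1)))
lemma2p14 H col _ _ (_ , _ , chain) b R R⊆X |R|≡2 =
  reflChain⇒powerBound H col b (chain b R (λ _ v∈R → R⊆X v∈R) |R|≡2)
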